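{- Let $\varepsilon>0$ and $c\in\mathbb R$, and let $M$ be an $\varepsilon$-approximately maximal matching in a graph $G$ with $|M|\le\left(\frac12+c\right)\mu(G)$. Then $M$ admits a collection of at least $\left(\frac12-3c-\frac{7\varepsilon}{2}\right)\mu(G)$ pairwise vertex-disjoint $3$-augmenting paths.
   Context: $\mu(G)$ is the maximum matching size of $G$. A matching $M$ is an $\varepsilon$-approximately maximal matching in $G$ if $M$ is an inclusion-wise maximal matching in some subgraph of $G$ obtained by deleting at most $\varepsilon\mu(G)$ vertices. A $3$-augmenting path with respect to $M$ is a path $u'-u-v-v'$ in $G$ with $(u,v)\in M$ and $u',v'$ distinct vertices not matched by $M$.
   Formalization: The parameters ε and c range over the rationals rather than over the reals. -}

module Defs where

open import Data.Nat using (ℕ)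
open import Data.Fin using (Fin)
open import Data.Product using (_×_; _,_; Σ; ∃; ∃-syntax)
open import Data.Sum using (_⊎_)
open import Data.List using (List; []; _∷_; length; concatMap)
open import Data.List.Membership.Propositional using (_∈_; _∉_)
open import Data.List.Relation.Unary.All using (All)
open import Data.List.Relation.Unary.Unique.Propositional using (Unique)
open import Data.Integer using (+_)
open import Data.Rational using (ℚ; _/_; _*_; _+_; _-_; _≤_; ½)
open import Relation.Binary.PropositionalEquality using (_≡_)
open import Relation.Nullary using (¬_)

record Graph (n : ℕ) : Set₁ where
  field
    Adj    : Fin n → Fin n → Set
    sym    : ∀ {u v} → Adj u v → Adj v u
    irrefl : ∀ {u} → ¬ Adj u u
open Graph public

ℕtoℚ : ℕ → ℚ
ℕtoℚ k = + k / 1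

Edge : ℕ → Set
Edge n = Fin n × Fin n

endpoints : ∀ {n} → List (Edge n) → List (Fin n)
endpoints = concatMap (λ { (u , v) → u ∷ v ∷ [] })

record IsMatching {n} (G : Graph n) (M : List (Edge n)) : Set where
  field
    edges    : All (λ { (u , v) → Adj G u v }) M
    disjoint : Unique (endpoints M)

Matched : ∀ {n} → List (Edge n) → Fin n → Set
Matched M x = x ∈ endpoints M

IsMaxMatchingSize : ∀ {n} → Graph n → ℕ → Set
IsMaxMatchingSize G m =
  (∃[ M ] (IsMatching G M × length M ≡ m)) ×
  (∀ M → IsMatching G M → Data.Nat._≤_ (length M) m)
  where import Data.Nat

-- M is an inclusion-wise maximal matching in G - D (D deleted vertices)
IsMaximalMatchingAvoiding : ∀ {n} → Graph n → List (Fin n) → List (Edge n) → Set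
IsMaximalMatchingAvoiding G D M =
  IsMatching G M ×
  All (_∉ D) (endpoints M) ×
  (∀ u v → Adj G u v → u ∉ D → v ∉ D → Matched M u ⊎ Matched M v)

IsApproxMaximal : ∀ {n} → Graph n → ℕ → ℚ → List (Edge n) → Set
IsApproxMaximal G mu ε M =
  ∃[ D ] (Unique D × ℕtoℚ (length D) ≤ ε * ℕtoℚ mu × IsMaximalMatchingAvoiding G D M)

-- a path u' - u - v - v' given as (u' , u , v , v')
Path3 : ℕ → Set
Path3 n = Fin n × Fin n × Fin n × Fin n

pathVertices : ∀ {n} → Path3 n → List (Fin n)
pathVertices (a , b , c , d) = a ∷ b ∷ c ∷ d ∷ []

Is3Augmenting : ∀ {n} → Graph n → List (Edge n) → Path3 n → Set
Is3Augmenting G M (u' , u , v , v') =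
  Adj G u' u × Adj G v v' ×
  ((u , v) ∈ M ⊎ (v , u) ∈ M) ×
  ¬ (u' ≡ v') × ¬ Matched M u' × ¬ Matched M v'

IsDisjoint3AugCollection : ∀ {n} → Graph n → List (Edge n) → List (Path3 n) → Set
IsDisjoint3AugCollection G M P =
  All (Is3Augmenting G M) P × Unique (concatMap pathVertices P)

module Submission where

-- Let M* be a matching of size μ and E the vertices covered by M. A vertex x covered by M* either
-- lies in E ∪ D, or its M*-partner lies in Q ∪ D, where Q ⊆ E consists of the vertices whose
-- M*-partner is not covered by M: if neither x nor its partner lies in E ∪ D, the edge between them
-- contradicts the maximality of M in G − D. As the partner map is injective, 2μ ≤ |E| + |D| + |Q| + |D|.
-- An edge uv of M puts at most one vertex into Q unless both u and v have uncovered partners u', v',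
-- and then u'–u–v–v' is 3-augmenting; these paths are vertex-disjoint, again by injectivity of the
-- partner map. So |Q| ≤ |M| + |P| and 2μ ≤ 3|M| + 2|D| + |P|, and the bound follows from
-- |M| ≤ (½ + c)μ and |D| ≤ εμ.

open import Defs
open import Data.Nat using (ℕ; suc)
open import Data.Fin using (Fin; _≟_)
open import Data.Product using (∃-syntax; _×_; _,_; proj₁; proj₂)
open import Data.Sum using (_⊎_; inj₁; inj₂)
open import Data.List using (List; []; _∷_; length; _++_; map; filter; concatMap)
open import Data.List.Properties using (length-++; length-map)
open import Data.List.Membership.Propositional using (_∈_; _∉_)
open import Data.List.Membership.Propositional.Properties
  using (∈-∃++; ∈-++⁺ˡ; ∈-++⁺ʳ; ∈-map⁺; ∈-map⁻; ∈-filter⁺; ∈-filter⁻)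
open import Data.List.Relation.Unary.Any using (here; there)
open import Data.List.Relation.Unary.All as All using (All; []; _∷_)
open import Data.List.Relation.Unary.Unique.Propositional using (Unique; []; _∷_)
import Data.List.Relation.Unary.Unique.Propositional.Properties as Unique
open import Data.List.Relation.Binary.Sublist.Propositional using ([]; _∷_; _∷ʳ_) renaming (_⊆_ to _⊑_)
open import Function.Definitions using (Injective)
open import Relation.Binary.Definitions using (DecidableEquality)
open import Relation.Nullary using (yes; no; ¬?; _×-dec_)
open import Relation.Nullary.Negation using (contradiction)
open import Relation.Unary using (Decidable)
import Relation.Binary.PropositionalEquality as ≡
open ≡ using (_≡_; _≢_; refl)

module UniqueCounting where

  open import Data.Nat using (_+_; _≤_; z≤n; s≤s)
  open import Data.Nat.Properties using (module ≤-Reasoning)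
  open import Data.Sum.Properties using (inj₂-injective)
  open import Data.List.Relation.Binary.Subset.Propositional using (_⊆_)
  open import Data.List.Relation.Binary.Sublist.Propositional.Properties using (All-resp-⊆)
  open import Data.List.Relation.Binary.Permutation.Propositional.Properties using (shift; ∈-resp-↭; ↭-length)

  module _ {A : Set} where

    Unique⇒length≤ : ∀ {xs ys : List A} → Unique xs → xs ⊆ ys → length xs ≤ length ys
    Unique⇒length≤ {[]} _ _ = z≤n
    Unique⇒length≤ {x ∷ xs} (x∉xs ∷ xs!) xs⊆ys with ∈-∃++ (xs⊆ys (here refl))
    ... | us , vs , refl = begin
      suc (length xs)        ≤⟨ s≤s (Unique⇒length≤ xs! xs⊆us++vs) ⟩
      length (x ∷ us ++ vs)  ≡⟨ ↭-length (shift x us vs) ⟨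
      length (us ++ x ∷ vs)  ∎
      where
      open ≤-Reasoning
      xs⊆us++vs : xs ⊆ us ++ vs
      xs⊆us++vs y∈xs with ∈-resp-↭ (shift x us vs) (xs⊆ys (there y∈xs))
      ... | here refl = contradiction refl (All.lookup x∉xs y∈xs)
      ... | there y∈us++vs = y∈us++vs

    Unique-resp-⊒ : ∀ {xs ys : List A} → xs ⊑ ys → Unique ys → Unique xs
    Unique-resp-⊒ [] [] = []
    Unique-resp-⊒ (_ ∷ʳ xs⊑ys) (_ ∷ ys!) = Unique-resp-⊒ xs⊑ys ys!
    Unique-resp-⊒ (refl ∷ xs⊑ys) (y∉ys ∷ ys!) = All-resp-⊆ xs⊑ys y∉ys ∷ Unique-resp-⊒ xs⊑ys ys!

  module _ {A : Set} (_≟ᴬ_ : DecidableEquality A) where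

    open import Data.List.Membership.DecPropositional _≟ᴬ_ using (_∈?_)

    length≤-by-cases : ∀ {xs ys zs : List A} (f : A → A) → Injective _≡_ _≡_ f → Unique xs →
      (∀ {x} → x ∈ xs → x ∈ ys ⊎ f x ∈ zs) → length xs ≤ length ys + length zs
    length≤-by-cases {xs} {ys} {zs} f f-injective xs! cases = begin
      length xs                            ≡⟨ length-map tag xs ⟨
      length (map tag xs)                  ≤⟨ Unique⇒length≤ (Unique.map⁺ tag-injective xs!) tag-∈ ⟩
      length (map inj₁ ys ++ map inj₂ zs)  ≡⟨ length-++ (map inj₁ ys) ⟩
      length (map inj₁ ys) + length (map inj₂ zs)
                                           ≡⟨ ≡.cong₂ _+_ (length-map inj₁ ys) (length-map inj₂ zs) ⟩
      length ys + length zs                ∎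
      where
      open ≤-Reasoning
      tag : A → A ⊎ A
      tag x with x ∈? ys
      ... | yes _ = inj₁ x
      ... | no _ = inj₂ (f x)

      tag-injective : Injective _≡_ _≡_ tag
      tag-injective {x} {y} eq with x ∈? ys | y ∈? ys | eq
      ... | yes _ | yes _ | refl = refl
      ... | no _  | no _  | fx≡fy = f-injective (inj₂-injective fx≡fy)

      tag-∈ : map tag xs ⊆ map inj₁ ys ++ map inj₂ zs
      tag-∈ t∈ with ∈-map⁻ tag t∈
      ... | x , x∈xs , refl with x ∈? ys | cases x∈xs
      ...   | yes x∈ys | _ = ∈-++⁺ˡ (∈-map⁺ inj₁ x∈ys)
      ...   | no x∉ys | inj₁ x∈ys = contradiction x∈ys x∉ys
      ...   | no _ | inj₂ fx∈zs = ∈-++⁺ʳ (map inj₁ ys) (∈-map⁺ inj₂ fx∈zs)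

open UniqueCounting

module MatchingPartners {n : ℕ} where

  open import Data.Nat using (_+_; _≤_; z≤n; s≤s)
  open import Data.Nat.Properties using (+-suc; m≤n⇒m≤1+n; ≤-trans; ≤-reflexive)
  open import Data.List.Membership.DecPropositional (_≟_ {n}) using (_∈?_)

  endpoints-⊑ : {L L' : List (Edge n)} → L ⊑ L' → endpoints L ⊑ endpoints L'
  endpoints-⊑ [] = []
  endpoints-⊑ ((u , v) ∷ʳ L⊑L') = u ∷ʳ v ∷ʳ endpoints-⊑ L⊑L'
  endpoints-⊑ (refl ∷ L⊑L') = refl ∷ refl ∷ endpoints-⊑ L⊑L'

  length-endpoints : (L : List (Edge n)) → length (endpoints L) ≡ length L + length L
  length-endpoints [] = refl
  length-endpoints (_ ∷ L) =
    ≡.cong suc (≡.trans (≡.cong suc (length-endpoints L)) (≡.sym (+-suc (length L) (length L))))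

  ∈-endpoints : ∀ {L : List (Edge n)} {u v} → (u , v) ∈ L → u ∈ endpoints L × v ∈ endpoints L
  ∈-endpoints {_ ∷ _} (here refl) = here refl , there (here refl)
  ∈-endpoints {_ ∷ _} (there uv∈L) with u∈ , v∈ ← ∈-endpoints uv∈L = there (there u∈) , there (there v∈)

  BothEnds : (Fin n → Set) → Edge n → Set
  BothEnds P (u , v) = P u × P v

  bothEnds? : {P : Fin n → Set} → Decidable P → Decidable (BothEnds P)
  bothEnds? P? (u , v) = P? u ×-dec P? v

  All-endpoints : ∀ {P L} → All (BothEnds P) L → All P (endpoints L)
  All-endpoints [] = []
  All-endpoints ((Pu , Pv) ∷ PL) = Pu ∷ Pv ∷ All-endpoints PL

  length-filter-endpoints : ∀ {P : Fin n → Set} (P? : Decidable P) (L : List (Edge n)) →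
    length (filter P? (endpoints L)) ≤ length L + length (filter (bothEnds? P?) L)
  length-filter-endpoints P? [] = z≤n
  length-filter-endpoints P? ((u , v) ∷ L) with ih ← length-filter-endpoints P? L | P? u
  ... | yes _ with P? v
  ...   | yes _ = s≤s (≤-trans (s≤s ih) (≤-reflexive (≡.sym (+-suc (length L) _))))
  ...   | no _  = s≤s ih
  length-filter-endpoints P? ((u , v) ∷ L) | no _ with P? v
  ...   | yes _ = s≤s ih
  ...   | no _  = m≤n⇒m≤1+n ih

  -- A vertex not covered by L is its own partner.
  partner : List (Edge n) → Fin n → Fin n
  partner [] x = x
  partner ((a , b) ∷ L) x with x ≟ a
  ... | yes _ = b
  ... | no _ with x ≟ b
  ...   | yes _ = a
  ...   | no _ = partner L x

  Partners : List (Edge n) → Fin n → Fin n → Set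
  Partners L x y = (x , y) ∈ L ⊎ (y , x) ∈ L

  partners-adjacent : ∀ {G : Graph n} {L x y} → IsMatching G L → Partners L x y → Adj G x y
  partners-adjacent L-matching (inj₁ xy∈L) = All.lookup (IsMatching.edges L-matching) xy∈L
  partners-adjacent {G} L-matching (inj₂ yx∈L) = sym G (All.lookup (IsMatching.edges L-matching) yx∈L)

  partner-∉ : ∀ L {x} → x ∉ endpoints L → partner L x ≡ x
  partner-∉ [] _ = refl
  partner-∉ ((a , b) ∷ L) {x} x∉ with x ≟ a
  ... | yes refl = contradiction (here refl) x∉
  ... | no _ with x ≟ b
  ...   | yes refl = contradiction (there (here refl)) x∉
  ...   | no _ = partner-∉ L (λ x∈ → x∉ (there (there x∈)))

  partner-∈ : ∀ L {x} → x ∈ endpoints L → Partners L x (partner L x)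
  partner-∈ ((a , b) ∷ L) {x} x∈ with x ≟ a
  ... | yes refl = inj₁ (here refl)
  ... | no x≢a with x ≟ b
  ...   | yes refl = inj₂ (here refl)
  ...   | no x≢b with x∈
  ...     | here x≡a = contradiction x≡a x≢a
  ...     | there (here x≡b) = contradiction x≡b x≢b
  ...     | there (there x∈L) with partner-∈ L x∈L
  ...       | inj₁ xy∈L = inj₁ (there xy∈L)
  ...       | inj₂ yx∈L = inj₂ (there yx∈L)

  partner-hitˡ : ∀ {a b L} → partner ((a , b) ∷ L) a ≡ b
  partner-hitˡ {a} with a ≟ a
  ... | yes _ = refl
  ... | no a≢a = contradiction refl a≢a

  partner-hitʳ : ∀ {a b L} → a ≢ b → partner ((a , b) ∷ L) b ≡ a
  partner-hitʳ {a} {b} a≢b with b ≟ a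
  ... | yes b≡a = contradiction (≡.sym b≡a) a≢b
  ... | no _ with b ≟ b
  ...   | yes _ = refl
  ...   | no b≢b = contradiction refl b≢b

  partner-skip : ∀ {a b L x} → x ≢ a → x ≢ b → partner ((a , b) ∷ L) x ≡ partner L x
  partner-skip {a} {b} {x = x} x≢a x≢b with x ≟ a
  ... | yes x≡a = contradiction x≡a x≢a
  ... | no _ with x ≟ b
  ...   | yes x≡b = contradiction x≡b x≢b
  ...   | no _ = refl

  partner-avoids : ∀ L {c x} → c ∉ endpoints L → x ≢ c → partner L x ≢ c
  partner-avoids L {c} {x} c∉ x≢c with x ∈? endpoints L
  ... | no x∉ = ≡.subst (_≢ c) (≡.sym (partner-∉ L x∉)) x≢c
  ... | yes x∈ with partner-∈ L x∈
  ...   | inj₁ xy∈L = λ { refl → c∉ (proj₂ (∈-endpoints xy∈L)) }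
  ...   | inj₂ yx∈L = λ { refl → c∉ (proj₁ (∈-endpoints yx∈L)) }

  partner-involutive : ∀ L → Unique (endpoints L) → ∀ x → partner L (partner L x) ≡ x
  partner-involutive [] _ x = refl
  partner-involutive ((a , b) ∷ L) (a∉ ∷ b∉ ∷ L!) x with x ≟ a
  ... | yes refl = partner-hitʳ {L = L} (All.head a∉)
  ... | no x≢a with x ≟ b
  ...   | yes refl = partner-hitˡ {a = a} {L = L}
  ...   | no x≢b = begin
    partner ((a , b) ∷ L) (partner L x)
      ≡⟨ partner-skip {L = L} (partner-avoids L a∉L x≢a) (partner-avoids L b∉L x≢b) ⟩
    partner L (partner L x)
      ≡⟨ partner-involutive L L! x ⟩
    x ∎
    where
    open ≡.≡-Reasoning
    a∉L : a ∉ endpoints L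
    a∉L a∈L = All.lookup (All.tail a∉) a∈L refl
    b∉L : b ∉ endpoints L
    b∉L b∈L = All.lookup b∉ b∈L refl

  partner-injective : ∀ L → Unique (endpoints L) → Injective _≡_ _≡_ (partner L)
  partner-injective L L! {x} {y} px≡py = begin
    x                        ≡⟨ partner-involutive L L! x ⟨
    partner L (partner L x)  ≡⟨ ≡.cong (partner L) px≡py ⟩
    partner L (partner L y)  ≡⟨ partner-involutive L L! y ⟩
    y                        ∎
    where open ≡.≡-Reasoning

open MatchingPartners

module AugmentingPaths {n} (G : Graph n) {M M* : List (Edge n)}
  (M-matching : IsMatching G M) (M*-matching : IsMatching G M*) where

  open import Data.Nat using (_+_; _≤_)
  open import Data.Nat.Properties using (module ≤-Reasoning; +-mono-≤; +-monoˡ-≤; ≤-reflexive)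
  open import Data.List.Membership.DecPropositional (_≟_ {n}) using (_∈?_)
  open import Data.List.Relation.Unary.All.Properties using (all-filter) renaming (map⁺ to All-map⁺)
  open import Data.List.Relation.Binary.Sublist.Propositional using (lookup)
  open import Data.List.Relation.Binary.Sublist.Propositional.Properties using (filter-⊆)
  open import Data.List.Relation.Binary.Disjoint.Propositional using (Disjoint)
  open import Data.List.Relation.Binary.Permutation.Propositional
    using (_↭_; ↭-refl; ↭-sym; ↭⇒↭ₛ; prep; module PermutationReasoning)
  open import Data.List.Relation.Binary.Permutation.Propositional.Properties using (shifts; ++⁺ˡ)
  open import Data.List.Relation.Binary.Permutation.Setoid.Properties using (Unique-resp-↭)

  M! : Unique (endpoints M)
  M! = IsMatching.disjoint M-matching

  M*! : Unique (endpoints M*)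
  M*! = IsMatching.disjoint M*-matching

  FreePartner : Fin n → Set
  FreePartner x = partner M* x ∉ endpoints M

  freePartner? : Decidable FreePartner
  freePartner? x = ¬? (partner M* x ∈? endpoints M)

  freePartner-partners : ∀ {x} → x ∈ endpoints M → FreePartner x → Partners M* x (partner M* x)
  freePartner-partners {x} x∈M free with x ∈? endpoints M*
  ... | yes x∈M* = partner-∈ M* x∈M*
  ... | no x∉M* = contradiction (≡.subst (_∈ endpoints M) (≡.sym (partner-∉ M* x∉M*)) x∈M) free

  augment : Edge n → Path3 n
  augment (u , v) = partner M* u , u , v , partner M* v

  augmentable : List (Edge n)
  augmentable = filter (bothEnds? freePartner?) M

  augmentingPaths : List (Path3 n)
  augmentingPaths = map augment augmentable

  augment-3augmenting : ∀ {u v} → (u , v) ∈ M → FreePartner u → FreePartner v →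
    Is3Augmenting G M (augment (u , v))
  augment-3augmenting {u} {v} uv∈M u-free v-free =
    sym G (partners-adjacent M*-matching (freePartner-partners (proj₁ (∈-endpoints uv∈M)) u-free)) ,
    partners-adjacent M*-matching (freePartner-partners (proj₂ (∈-endpoints uv∈M)) v-free) ,
    inj₁ uv∈M ,
    (λ pu≡pv → irrefl G (≡.subst (Adj G u) (≡.sym (partner-injective M* M*! pu≡pv)) u~v)) ,
    u-free ,
    v-free
    where
    u~v : Adj G u v
    u~v = All.lookup (IsMatching.edges M-matching) uv∈M

  augment-vertices : ∀ F →
    concatMap pathVertices (map augment F) ↭ endpoints F ++ map (partner M*) (endpoints F)
  augment-vertices [] = ↭-refl
  augment-vertices ((u , v) ∷ F) = begin
    pu ∷ u ∷ v ∷ pv ∷ concatMap pathVertices (map augment F)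
      ↭⟨ ++⁺ˡ (pu ∷ u ∷ v ∷ pv ∷ []) (augment-vertices F) ⟩
    pu ∷ u ∷ v ∷ pv ∷ eF ++ wF  ↭⟨ shifts (pu ∷ []) (u ∷ v ∷ []) ⟩
    u ∷ v ∷ pu ∷ pv ∷ eF ++ wF  ↭⟨ prep u (prep v (shifts (pu ∷ pv ∷ []) eF)) ⟩
    u ∷ v ∷ eF ++ pu ∷ pv ∷ wF  ∎
    where
    open PermutationReasoning
    pu pv : Fin n
    pu = partner M* u
    pv = partner M* v
    eF wF : List (Fin n)
    eF = endpoints F
    wF = map (partner M*) eF

  augmentingPaths-disjoint : Unique (concatMap pathVertices augmentingPaths)
  augmentingPaths-disjoint =
    Unique-resp-↭ (≡.setoid _) (↭⇒↭ₛ (↭-sym (augment-vertices augmentable)))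
      (Unique.++⁺ A! (Unique.map⁺ (partner-injective M* M*!) A!) disjoint)
    where
    A⊑M : endpoints augmentable ⊑ endpoints M
    A⊑M = endpoints-⊑ (filter-⊆ (bothEnds? freePartner?) M)
    A! : Unique (endpoints augmentable)
    A! = Unique-resp-⊒ A⊑M M!
    disjoint : Disjoint (endpoints augmentable) (map (partner M*) (endpoints augmentable))
    disjoint (x∈A , x∈pA) with ∈-map⁻ (partner M*) x∈pA
    ... | z , z∈A , refl =
      All.lookup (All-endpoints (all-filter (bothEnds? freePartner?) M)) z∈A (lookup A⊑M x∈A)

  augmentingPaths-collection : IsDisjoint3AugCollection G M augmentingPaths
  augmentingPaths-collection = All-map⁺ (All.tabulate augmentable-3augmenting) , augmentingPaths-disjoint
    where
    augmentable-3augmenting : ∀ {e} → e ∈ augmentable → Is3Augmenting G M (augment e)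
    augmentable-3augmenting e∈A with e∈M , (u-free , v-free) ← ∈-filter⁻ (bothEnds? freePartner?) e∈A =
      augment-3augmenting e∈M u-free v-free

  module _ {D : List (Fin n)}
    (maximal : ∀ u v → Adj G u v → u ∉ D → v ∉ D → Matched M u ⊎ Matched M v) where

    M*-endpoint-cases : ∀ {x} → x ∈ endpoints M* →
      x ∈ endpoints M ++ D ⊎ partner M* x ∈ filter freePartner? (endpoints M) ++ D
    M*-endpoint-cases {x} x∈M* with x ∈? endpoints M
    ... | yes x∈M = inj₁ (∈-++⁺ˡ x∈M)
    ... | no x∉M with partner M* x ∈? endpoints M
    ...   | yes px∈M = inj₂ (∈-++⁺ˡ (∈-filter⁺ freePartner? px∈M ppx∉M))
      where
      ppx∉M : FreePartner (partner M* x)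
      ppx∉M = ≡.subst (_∉ endpoints M) (≡.sym (partner-involutive M* M*! x)) x∉M
    ...   | no px∉M with x ∈? D
    ...     | yes x∈D = inj₁ (∈-++⁺ʳ (endpoints M) x∈D)
    ...     | no x∉D with partner M* x ∈? D
    ...       | yes px∈D = inj₂ (∈-++⁺ʳ _ px∈D)
    ...       | no px∉D with maximal x (partner M* x) (partners-adjacent M*-matching (partner-∈ M* x∈M*)) x∉D px∉D
    ...         | inj₁ x∈M = contradiction x∈M x∉M
    ...         | inj₂ px∈M = contradiction px∈M px∉M

    matching-count : length M* + length M* ≤
      (length M + length M + length D) + (length M + length augmentingPaths + length D)
    matching-count = begin
      length M* + length M*                        ≡⟨ length-endpoints M* ⟨
      length (endpoints M*)
        ≤⟨ length≤-by-cases _≟_ (partner M*) (partner-injective M* M*!) M*! M*-endpoint-cases ⟩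
      length (endpoints M ++ D) + length (Q ++ D)  ≡⟨ ≡.cong₂ _+_ (length-++ (endpoints M)) (length-++ Q) ⟩
      (length (endpoints M) + length D) + (length Q + length D)
        ≤⟨ +-mono-≤ (≤-reflexive (≡.cong (_+ length D) (length-endpoints M))) (+-monoˡ-≤ (length D) Q≤) ⟩
      (length M + length M + length D) + (length M + length augmentingPaths + length D) ∎
      where
      open ≤-Reasoning
      Q : List (Fin n)
      Q = filter freePartner? (endpoints M)
      Q≤ : length Q ≤ length M + length augmentingPaths
      Q≤ = ≡.subst (λ k → length Q ≤ length M + k) (≡.sym (length-map augment augmentable))
             (length-filter-endpoints freePartner? M)

import Data.Nat as ℕ
open import Data.Nat.Coprimality as Coprimality using (Coprime; 1-coprimeTo)
open import Data.Integer as ℤ using (+_; +≤+)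
import Data.Integer.Properties as ℤ
open import Data.Integer.Solver using (module +-*-Solver)
open import Data.Rational using (ℚ; mkℚ; _/_; _*_; _+_; _-_; -_; _≤_; _<_; ½; 0ℚ; *≤*; nonNegative)
open import Data.Rational.Properties
  using (normalize-coprime; toℚᵘ-injective; toℚᵘ-homo-+; +-monoˡ-≤; +-monoʳ-≤; +-mono-≤;
         +-inverseʳ; +-identityʳ; *-zeroʳ; *-monoˡ-≤-nonNeg; nonNegative⁻¹)
import Data.Rational.Unnormalised as ℚᵘ
import Data.Rational.Unnormalised.Properties as ℚᵘ
open import Data.Rational.Solver using () renaming (module +-*-Solver to ℚ-Solver)

coprime-1 : ∀ k → Coprime k 1
coprime-1 k = Coprimality.sym (1-coprimeTo k)

ℕtoℚ≡mkℚ : ∀ k → ℕtoℚ k ≡ mkℚ (+ k) 0 (coprime-1 k)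
ℕtoℚ≡mkℚ k = normalize-coprime (coprime-1 k)

ℕtoℚ-+ : ∀ a b → ℕtoℚ (a ℕ.+ b) ≡ ℕtoℚ a + ℕtoℚ b
ℕtoℚ-+ a b rewrite ℕtoℚ≡mkℚ a | ℕtoℚ≡mkℚ b | ℕtoℚ≡mkℚ (a ℕ.+ b) =
  toℚᵘ-injective (ℚᵘ.≃-trans (ℚᵘ.*≡* cross-multiplied)
    (ℚᵘ.≃-sym (toℚᵘ-homo-+ (mkℚ (+ a) 0 (coprime-1 a)) (mkℚ (+ b) 0 (coprime-1 b)))))
  where
  open +-*-Solver
  cross-multiplied : (+ a ℤ.+ + b) ℤ.* (+ 1 ℤ.* + 1) ≡ (+ a ℤ.* + 1 ℤ.+ + b ℤ.* + 1) ℤ.* + 1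
  cross-multiplied =
    solve 2 (λ x y → (x :+ y) :* (con (+ 1) :* con (+ 1)) := (x :* con (+ 1) :+ y :* con (+ 1)) :* con (+ 1))
      refl (+ a) (+ b)

ℕtoℚ-+₃ : ∀ a b c → ℕtoℚ (a ℕ.+ b ℕ.+ c) ≡ ℕtoℚ a + ℕtoℚ b + ℕtoℚ c
ℕtoℚ-+₃ a b c = ≡.trans (ℕtoℚ-+ (a ℕ.+ b) c) (≡.cong (_+ ℕtoℚ c) (ℕtoℚ-+ a b))

ℕtoℚ-mono-≤ : ∀ {a b} → a ℕ.≤ b → ℕtoℚ a ≤ ℕtoℚ b
ℕtoℚ-mono-≤ {a} {b} a≤b rewrite ℕtoℚ≡mkℚ a | ℕtoℚ≡mkℚ b = *≤* (ℤ.*-monoʳ-≤-nonNeg (+ 1) (+≤+ a≤b))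

0≤ℕtoℚ : ∀ k → 0ℚ ≤ ℕtoℚ k
0≤ℕtoℚ k = ℕtoℚ-mono-≤ (ℕ.z≤n {k})

0≤p-q : ∀ {p q} → q ≤ p → 0ℚ ≤ p - q
0≤p-q {p} {q} q≤p = ≡.subst (_≤ p - q) (+-inverseʳ q) (+-monoˡ-≤ (- q) q≤p)

0≤+ : ∀ {p q} → 0ℚ ≤ p → 0ℚ ≤ q → 0ℚ ≤ p + q
0≤+ {p} {q} 0≤p 0≤q = ≡.subst (_≤ p + q) (+-identityʳ 0ℚ) (+-mono-≤ 0≤p 0≤q)

0≤* : ∀ {p q} → 0ℚ ≤ p → 0ℚ ≤ q → 0ℚ ≤ p * q
0≤* {p} {q} 0≤p 0≤q = ≡.subst (_≤ p * q) (*-zeroʳ p) (*-monoˡ-≤-nonNeg p {{nonNegative 0≤p}} 0≤q)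

≤-+-slack : ∀ {p q t} → 0ℚ ≤ t → p ≡ q + t → q ≤ p
≤-+-slack {p} {q} {t} 0≤t p≡q+t = ≡.subst₂ _≤_ (+-identityʳ q) (≡.sym p≡q+t) (+-monoʳ-≤ q 0≤t)

counting⇒bound : ∀ (μ m d g : ℕ) (ε c : ℚ) →
  μ ℕ.+ μ ℕ.≤ (m ℕ.+ m ℕ.+ d) ℕ.+ (m ℕ.+ g ℕ.+ d) →
  ℕtoℚ m ≤ (½ + c) * ℕtoℚ μ →
  ℕtoℚ d ≤ ε * ℕtoℚ μ →
  (½ - ℕtoℚ 3 * c - (ℕtoℚ 7 * ε) * ½) * ℕtoℚ μ ≤ ℕtoℚ g
counting⇒bound μ m d g ε c count m≤ d≤ = ≤-+-slack 0≤slack g≡bound+slack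
  where
  x M D G : ℚ
  x = ℕtoℚ μ
  M = ℕtoℚ m
  D = ℕtoℚ d
  G = ℕtoℚ g
  count′ : x + x ≤ (M + M + D) + (M + G + D)
  count′ = ≡.subst₂ _≤_ (ℕtoℚ-+ μ μ)
    (≡.trans (ℕtoℚ-+ (m ℕ.+ m ℕ.+ d) _) (≡.cong₂ _+_ (ℕtoℚ-+₃ m m d) (ℕtoℚ-+₃ m g d)))
    (ℕtoℚ-mono-≤ count)
  -- g minus the bound: the slacks of count′, m≤ and d≤ with weights 1, 3 and 7/2, plus (3/2)d
  slack : ℚ
  slack = ((M + M + D) + (M + G + D) - (x + x)) + (ℕtoℚ 3 * ((½ + c) * x - M)
          + ((+ 7 / 2) * (ε * x - D) + (+ 3 / 2) * D))
  0≤slack : 0ℚ ≤ slack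
  0≤slack = 0≤+ (0≤p-q count′) (0≤+ (0≤* (0≤ℕtoℚ 3) (0≤p-q m≤))
    (0≤+ (0≤* (nonNegative⁻¹ (+ 7 / 2)) (0≤p-q d≤)) (0≤* (nonNegative⁻¹ (+ 3 / 2)) (0≤ℕtoℚ d))))
  open ℚ-Solver
  g≡bound+slack : G ≡ (½ - ℕtoℚ 3 * c - (ℕtoℚ 7 * ε) * ½) * x + slack
  g≡bound+slack = solve 6 (λ G x M D c ε →
    G := (con ½ :- con (ℕtoℚ 3) :* c :- (con (ℕtoℚ 7) :* ε) :* con ½) :* x
         :+ (((M :+ M :+ D) :+ (M :+ G :+ D) :- (x :+ x)) :+ (con (ℕtoℚ 3) :* ((con ½ :+ c) :* x :- M)
         :+ (con (+ 7 / 2) :* (ε :* x :- D) :+ con (+ 3 / 2) :* D))))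
    refl G x M D c ε

proposition2p6 : ∀ {n} (G : Graph n) (mu : ℕ) (ε c : ℚ) (M : List (Edge n)) →
    IsMaxMatchingSize G mu → 0ℚ < ε →
    IsApproxMaximal G mu ε M →
    ℕtoℚ (length M) ≤ (½ + c) * ℕtoℚ mu →
    ∃[ P ] (IsDisjoint3AugCollection G M P ×
      (½ - ℕtoℚ 3 * c - (ℕtoℚ 7 * ε) * ½) * ℕtoℚ mu ≤ ℕtoℚ (length P))
proposition2p6 G mu ε c M ((M* , M*-matching , |M*|≡mu) , _) _ (D , _ , |D|≤ , M-matching , _ , maximal) |M|≤ =
  augmentingPaths , augmentingPaths-collection ,
  counting⇒bound mu (length M) (length D) (length augmentingPaths) ε c count |M|≤ |D|≤
  where
  open AugmentingPaths G M-matching M*-matching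
  count : mu ℕ.+ mu ℕ.≤ (length M ℕ.+ length M ℕ.+ length D) ℕ.+ (length M ℕ.+ length augmentingPaths ℕ.+ length D)
  count = ≡.subst (λ k → k ℕ.+ k ℕ.≤ _) |M*|≡mu (matching-count maximal)
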